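{- Let $\mathbf S=(S,\leq,*,1)$ be a skew Hilbert algebra. For $p\in S$ and $x\in[p,1]$ put $x^p:=x*p$. Then $(S,\leq,1,({}^p:p\in S))$ is a poset with sectional Brouwerian pseudocomplements.
   Context: For a poset and a subset $A$, $L(A)$ and $U(A)$ denote the sets of lower and upper bounds of $A$; $L(a,b)=L(\{a,b\})$, $L(U(x,y),z)=L(U(\{x,y\})\cup\{z\})$; $[p,1]=\{x: p\leq x\leq 1\}$. A skew Hilbert algebra is a poset $(S,\leq,*,1)$ with binary operation $*$ and constant $1$ such that for all $x,y,z$: (S1) $x\leq y$ iff $x*y=1$; (S2) if $y*x=1$ then $x*((x*y)*y)=1$; (S3) if $x*y=1$ then $(y*z)*(x*z)=1$; (S4) $L(U(x,y),x*y)=L(y)$. A poset with sectional Brouwerian pseudocomplements is a structure $(A,\leq,1,({}^p:p\in A))$ where $(A,\leq)$ is a poset with top element $1$ and for each $p\in A$, ${}^p$ is a unary operation on $[p,1]$ such that for all $x,y\in[p,1]$: (BP1) $x\leq y$ implies $y^p\leq x^p$; (BP2) $x\leq x^{pp}$; (BP3) $L(x,x^p)=L(p)$. -}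

module Defs where

open import Level using (Level; _⊔_; suc)
open import Data.Product using (_×_; _,_)
open import Data.Sum using (_⊎_)
open import Relation.Binary.PropositionalEquality using (_≡_)
open import Relation.Binary.Structures using (IsPartialOrder)
open import Relation.Binary.Core using (Rel)

module Bounds {a ℓ : Level} {S : Set a} (_≤_ : Rel S ℓ) where

  Pred : Set (suc (a ⊔ ℓ))
  Pred = S → Set (a ⊔ ℓ)

  L : (S → Set (a ⊔ ℓ)) → S → Set (a ⊔ ℓ)
  L A z = ∀ w → A w → z ≤ w

  U : (S → Set (a ⊔ ℓ)) → S → Set (a ⊔ ℓ)
  U A z = ∀ w → A w → w ≤ z

  sing : S → S → Set (a ⊔ ℓ)
  sing x w = Level.Lift (a ⊔ ℓ) (w ≡ x)

  pair : S → S → S → Set (a ⊔ ℓ)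
  pair x y w = Level.Lift (a ⊔ ℓ) ((w ≡ x) ⊎ (w ≡ y))

  _∪_ : (S → Set (a ⊔ ℓ)) → (S → Set (a ⊔ ℓ)) → S → Set (a ⊔ ℓ)
  (A ∪ B) w = A w ⊎ B w

  _≐_ : (S → Set (a ⊔ ℓ)) → (S → Set (a ⊔ ℓ)) → Set (a ⊔ ℓ)
  A ≐ B = ∀ w → (A w → B w) × (B w → A w)

record IsSkewHilbertAlgebra {a ℓ : Level} {S : Set a}
    (_≤_ : Rel S ℓ) (_*_ : S → S → S) (𝟏 : S) : Set (suc (a ⊔ ℓ)) where
  open Bounds _≤_
  field
    isPartialOrder : IsPartialOrder _≡_ _≤_
    S1 : ∀ x y → (x ≤ y → x * y ≡ 𝟏) × (x * y ≡ 𝟏 → x ≤ y)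
    S2 : ∀ x y → y * x ≡ 𝟏 → x * ((x * y) * y) ≡ 𝟏
    S3 : ∀ x y z → x * y ≡ 𝟏 → (y * z) * (x * z) ≡ 𝟏
    S4 : ∀ x y → L (U (pair x y) ∪ sing (x * y)) ≐ L (sing y)

-- Poset with sectional Brouwerian pseudocomplements (A, ≤, 1, (^p : p ∈ A)).
-- The operation ^p on [p,1] is given as  pc p x (p≤x) , required to land in [p,1].
record IsSectionalBP {a ℓ : Level} {S : Set a}
    (_≤_ : Rel S ℓ) (𝟏 : S) (pc : (p x : S) → p ≤ x → S) : Set (suc (a ⊔ ℓ)) where
  open Bounds _≤_
  field
    isPartialOrder : IsPartialOrder _≡_ _≤_
    top : ∀ x → x ≤ 𝟏
    -- ^p maps [p,1] into [p,1]  (upper bound 1 is automatic from `top`)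
    closed : ∀ p x (px : p ≤ x) → p ≤ pc p x px
    BP1 : ∀ p x y (px : p ≤ x) (py : p ≤ y) → x ≤ y → pc p y py ≤ pc p x px
    BP2 : ∀ p x (px : p ≤ x) → x ≤ pc p (pc p x px) (closed p x px)
    BP3 : ∀ p x (px : p ≤ x) → L (pair x (pc p x px)) ≐ L (sing p)

-- Every element below x and x * p is below every upper bound of {x, p} and
-- below x * p, so axiom (S4) places it below p; conversely p ≤ x and p ≤ x * p.
-- Antitonicity and x ≤ (x * p) * p are (S3) and (S2) read through (S1).
module Submission where

open import Defs
open import Level using (Level; lift)
open import Relation.Binary.Core using (Rel)
open import Relation.Binary.Structures using (IsPartialOrder)
open import Relation.Binary.PropositionalEquality using (_≡_; refl; subst)
open import Data.Product using (_,_; proj₁; proj₂)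
open import Data.Sum using (inj₁; inj₂)

module BoundsOfFiniteSets {a ℓ : Level} {S : Set a} (_≤_ : Rel S ℓ) where
  open Bounds _≤_

  L-pair : ∀ {x y z} → z ≤ x → z ≤ y → L (pair x y) z
  L-pair z≤x z≤y _ (lift (inj₁ refl)) = z≤x
  L-pair z≤x z≤y _ (lift (inj₂ refl)) = z≤y

  L-pair-left : ∀ {x y z} → L (pair x y) z → z ≤ x
  L-pair-left z∈L = z∈L _ (lift (inj₁ refl))

  L-pair-right : ∀ {x y z} → L (pair x y) z → z ≤ y
  L-pair-right z∈L = z∈L _ (lift (inj₂ refl))

  L-sing : ∀ {x z} → z ≤ x → L (sing x) z
  L-sing z≤x _ (lift refl) = z≤x

  L-sing-elim : ∀ {x z} → L (sing x) z → z ≤ x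
  L-sing-elim z∈L = z∈L _ (lift refl)

  U-pair-left : ∀ {x y u} → U (pair x y) u → x ≤ u
  U-pair-left u∈U = u∈U _ (lift (inj₁ refl))

module SkewHilbertAlgebraProperties
    {a ℓ : Level} {S : Set a} {_≤_ : Rel S ℓ} {_*_ : S → S → S} {𝟏 : S}
    (H : IsSkewHilbertAlgebra _≤_ _*_ 𝟏) where
  open IsSkewHilbertAlgebra H
  open IsPartialOrder isPartialOrder using (trans) renaming (refl to ≤-refl)
  open Bounds _≤_
  open BoundsOfFiniteSets _≤_

  ≤⇒*≡𝟏 : ∀ {x y} → x ≤ y → x * y ≡ 𝟏
  ≤⇒*≡𝟏 = proj₁ (S1 _ _)

  *≡𝟏⇒≤ : ∀ {x y} → x * y ≡ 𝟏 → x ≤ y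
  *≡𝟏⇒≤ = proj₂ (S1 _ _)

  y≤x*y : ∀ x y → y ≤ (x * y)
  y≤x*y x y = proj₂ (S4 x y y) (L-sing ≤-refl) (x * y) (inj₂ (lift refl))

  x≤𝟏 : ∀ x → x ≤ 𝟏
  x≤𝟏 x = subst (x ≤_) (≤⇒*≡𝟏 ≤-refl) (y≤x*y x x)

  *-antitoneˡ : ∀ {x y} z → x ≤ y → (y * z) ≤ (x * z)
  *-antitoneˡ {x} {y} z x≤y = *≡𝟏⇒≤ (S3 x y z (≤⇒*≡𝟏 x≤y))

  x≤[x*y]*y : ∀ {x y} → y ≤ x → x ≤ ((x * y) * y)
  x≤[x*y]*y {x} {y} y≤x = *≡𝟏⇒≤ (S2 x y (≤⇒*≡𝟏 y≤x))

  L[x,x*y]⊆L[y] : ∀ {x y z} → L (pair x (x * y)) z → z ≤ y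
  L[x,x*y]⊆L[y] {x} {y} {z} z∈L = L-sing-elim (proj₁ (S4 x y z) below-S4-set)
    where
    below-S4-set : L (U (pair x y) ∪ sing (x * y)) z
    below-S4-set _ (inj₁ u∈U)         = trans (L-pair-left z∈L) (U-pair-left u∈U)
    below-S4-set _ (inj₂ (lift refl)) = L-pair-right z∈L

  L[x,x*y]≐L[y] : ∀ {x y} → y ≤ x → L (pair x (x * y)) ≐ L (sing y)
  L[x,x*y]≐L[y] {x} {y} y≤x z =
      (λ z∈L → L-sing (L[x,x*y]⊆L[y] z∈L))
    , (λ z∈L → let z≤y = L-sing-elim z∈L in
         L-pair (trans z≤y y≤x) (trans z≤y (y≤x*y x y)))

mainTheorem4 : {a ℓ : Level} {S : Set a} (_≤_ : Rel S ℓ) (_*_ : S → S → S) (𝟏 : S) →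
    IsSkewHilbertAlgebra _≤_ _*_ 𝟏 →
    IsSectionalBP _≤_ 𝟏 (λ p x _ → x * p)
mainTheorem4 _≤_ _*_ 𝟏 H = record
  { isPartialOrder = isPartialOrder
  ; top            = x≤𝟏
  ; closed         = λ p x _ → y≤x*y x p
  ; BP1            = λ p _ _ _ _ → *-antitoneˡ p
  ; BP2            = λ _ _ p≤x → x≤[x*y]*y p≤x
  ; BP3            = λ _ _ p≤x → L[x,x*y]≐L[y] p≤x
  }
  where
  open IsSkewHilbertAlgebra H using (isPartialOrder)
  open SkewHilbertAlgebraProperties H
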